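{- Let $q=2$, $A=\mathbb{F}_2[t]$, $K=\mathbb{F}_2(t)$. Let $a,b$ be integers with $a>b\ge1$ and let $m$ be the smallest nonnegative integer with $a\le 2^m$. Then $$\Delta(a,b)=\sum_{k=0}^{a-1}f_kS_1(a-k),\qquad f_k=\sum_{\substack{i+j=k\\ 0\le i\le 2^m-a\\ 0\le j\le a-b-1}}\binom{2^m-a}{i}\binom{a-b}{j}\in\mathbb{F}_2 .$$
   Context: For $s\in\mathbb{Z}$, $S_1(s)=t^{ -s}+(t+1)^{ -s}\in K$ (the sum of $n^{ -s}$ over the monic polynomials $n$ of degree $1$). For $a,b\in\mathbb{Z}_+$, $\Delta(a,b)=S_1(a)S_1(b)-S_1(a+b)$. -}

module Defs where

open import Data.Bool using (Bool; true; false; _xor_; _∧_; if_then_else_)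
open import Data.List using (List; []; _∷_)
open import Data.Nat using (ℕ; zero; suc; _+_; _*_; _∸_; _^_; _≤ᵇ_; _%_; _≡ᵇ_)
open import Data.Nat.Combinatorics using (_C_)
open import Relation.Binary.PropositionalEquality using (_≡_)

-- A = F₂[t] : polynomials over F₂ = Bool (xor as +, ∧ as *),
-- coefficient lists, lowest degree first (trailing zeros allowed).

Poly : Set
Poly = List Bool

coeff : Poly → ℕ → Bool
coeff []       _       = false
coeff (c ∷ p)  zero    = c
coeff (c ∷ p)  (suc n) = coeff p n

_≈P_ : Poly → Poly → Set
p ≈P q = ∀ n → coeff p n ≡ coeff q n

_+P_ : Poly → Poly → Poly
[]      +P q       = q
(c ∷ p) +P []      = c ∷ p
(c ∷ p) +P (d ∷ q) = (c xor d) ∷ (p +P q)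

-- in characteristic 2, -p = p
-P_ : Poly → Poly
-P p = p

_*P_ : Poly → Poly → Poly
[]      *P q = []
(c ∷ p) *P q = (if c then q else []) +P (false ∷ (p *P q))

oneP : Poly
oneP = true ∷ []

zeroP : Poly
zeroP = []

_^P_ : Poly → ℕ → Poly
p ^P zero  = oneP
p ^P suc n = p *P (p ^P n)

tP : Poly
tP = false ∷ true ∷ []

t+1P : Poly
t+1P = true ∷ true ∷ []

-- K = F₂(t) : fractions num / den (den nonzero for all fractions built
-- below), with the usual field-of-fractions equality.

record K : Set where
  constructor _/_
  field
    num : Poly
    den : Poly
open K public

_≈K_ : K → K → Set
x ≈K y = (num x *P den y) ≈P (num y *P den x)

_+K_ : K → K → K
x +K y = ((num x *P den y) +P (num y *P den x)) / (den x *P den y)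

-K_ : K → K
-K x = (-P num x) / den x

_-K_ : K → K → K
x -K y = x +K (-K y)

_*K_ : K → K → K
x *K y = (num x *P num y) / (den x *P den y)

zeroK : K
zeroK = zeroP / oneP

fromF₂ : Bool → K
fromF₂ c = (if c then oneP else zeroP) / oneP

-- S₁(s) = t^{-s} + (t+1)^{-s}  (only needed for s ∈ ℤ₊ here, s : ℕ)

S₁ : ℕ → K
S₁ s = (oneP / (tP ^P s)) +K (oneP / (t+1P ^P s))

Δ : ℕ → ℕ → K
Δ a b = (S₁ a *K S₁ b) -K S₁ (a + b)

sumℕ : ℕ → (ℕ → ℕ) → ℕ
sumℕ zero    f = 0
sumℕ (suc n) f = sumℕ n f + f n

sumK : ℕ → (ℕ → K) → K
sumK zero    g = zeroK
sumK (suc n) g = sumK n g +K g n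

toF₂ : ℕ → Bool
toF₂ n = (n % 2) ≡ᵇ 1

fcoef : ℕ → ℕ → ℕ → ℕ → Bool
fcoef a b m k = toF₂ (sumℕ (suc k) λ i →
  if (i ≤ᵇ (2 ^ m ∸ a)) ∧ ((k ∸ i) ≤ᵇ (a ∸ b ∸ 1))
  then ((2 ^ m ∸ a) C i) * ((a ∸ b) C (k ∸ i))
  else 0)

module Submission where

-- Theorem 6.1 for q = 2: if b < a ≤ 2^m then Δ(a, b) = Σ_{k<a} f_k S₁(a - k).
--
-- Write T = t, U = t + 1, c = a - b and E = Uᶜ + Tᶜ, so S₁(s) = (Uˢ + Tˢ)/(TˢUˢ).
-- Over the common denominator T^(a+b) U^(a+b) the left side has numerator E·TᵇUᵇ,
-- and the right side is (Uᵃ A + Tᵃ σA)/(TᵃUᵃ), where A = Σ_{k<a} f_k tᵏ and σ is the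
-- involution t ↦ t + 1.  So everything reduces to the identity Uᵃ A + Tᵃ σA = E
-- (key-identity).  By Pascal's rule mod 2, f_k is the k-th coefficient of
-- U^(2^m - a) E, hence Uᵃ A ≡ U^(2^m) E = (1 + T^(2^m)) E ≡ E (mod Tᵃ) by Frobenius;
-- and a σ-invariant polynomial of degree < 2a divisible by Tᵃ vanishes, since U is
-- a unit mod Tᵃ (symmetric-completion).

open import Defs
open import Data.Nat using (ℕ; _≤_; _<_; _∸_; _^_)
open import Data.Nat using (zero; suc; _+_; _*_; z≤n; s≤s; _%_; _≡ᵇ_; _≤ᵇ_)
import Data.Nat.Properties as ℕₚ
open import Data.Bool using (Bool; true; false; _xor_; _∧_; not; if_then_else_) renaming (T to True)
open import Data.Bool.Properties using (xor-assoc; xor-comm; xor-same; xor-identityʳ; not-distribˡ-xor; not-involutive; ∧-zeroʳ; ∧-identityʳ)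
open import Data.Empty using (⊥-elim)
open import Data.Nat.Combinatorics using (_C_; nCn≡1; k>n⇒nCk≡0; nCk+nC[k+1]≡[n+1]C[k+1])
import Data.Nat.DivMod
open import Data.List using ([]; _∷_)
open import Relation.Binary.PropositionalEquality as ≡ using (_≡_; _≢_; refl; cong; cong₂)
open import Relation.Binary.Bundles using (Setoid)
open import Algebra.Bundles using (CommutativeRing)
open import Data.Product using (_,_)
open import Data.Sum using (_⊎_; inj₁; inj₂)
open import Relation.Nullary.Reflects using (ofʸ; ofⁿ)
open import Data.Maybe as Maybe using (Maybe; just; nothing)
open import Tactic.RingSolver using (solve-∀)
open import Tactic.RingSolver.Core.AlmostCommutativeRing using (AlmostCommutativeRing; fromCommutativeRing)
import Relation.Binary.Reasoning.Setoid as SetoidReasoning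

infix 4 _≈_
infixl 6 _⊕_
infixl 7 _⊛_

-- Equality in A = F₂[t]: all coefficients agree.  It is wrapped in a
-- record so that both polynomials can be inferred from the type.
record _≈_ (p q : Poly) : Set where
  constructor mk≈
  field coeff-≈ : ∀ n → coeff p n ≡ coeff q n
open _≈_ public

≈-refl : ∀ {p} → p ≈ p
≈-refl = mk≈ λ _ → refl

≈-sym : ∀ {p q} → p ≈ q → q ≈ p
≈-sym h = mk≈ λ n → ≡.sym (coeff-≈ h n)

≈-trans : ∀ {p q r} → p ≈ q → q ≈ r → p ≈ r
≈-trans h g = mk≈ λ n → ≡.trans (coeff-≈ h n) (coeff-≈ g n)

≈-reflexive : ∀ {p q} → p ≡ q → p ≈ q
≈-reflexive refl = ≈-refl

≈-setoid : Setoid _ _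
≈-setoid = record
  { Carrier = Poly ; _≈_ = _≈_
  ; isEquivalence = record { refl = ≈-refl ; sym = ≈-sym ; trans = ≈-trans } }

module ≈-Reasoning = SetoidReasoning ≈-setoid

_⊕_ _⊛_ : Poly → Poly → Poly
_⊕_ = _+P_
_⊛_ = _*P_

∷-cong : ∀ {c d p q} → c ≡ d → p ≈ q → (c ∷ p) ≈ (d ∷ q)
∷-cong e h = mk≈ λ { zero → e ; (suc n) → coeff-≈ h n }

∷-tail : ∀ {c d p q} → (c ∷ p) ≈ (d ∷ q) → p ≈ q
∷-tail h = mk≈ λ n → coeff-≈ h (suc n)

false∷[]≈[] : (false ∷ []) ≈ []
false∷[]≈[] = mk≈ λ { zero → refl ; (suc n) → refl }

coeff-⊕ : ∀ p q n → coeff (p ⊕ q) n ≡ coeff p n xor coeff q n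
coeff-⊕ []      q       n       = refl
coeff-⊕ (c ∷ p) []      zero    = ≡.sym (xor-identityʳ c)
coeff-⊕ (c ∷ p) []      (suc n) = ≡.sym (xor-identityʳ (coeff p n))
coeff-⊕ (c ∷ p) (d ∷ q) zero    = refl
coeff-⊕ (c ∷ p) (d ∷ q) (suc n) = coeff-⊕ p q n

-- Hence every additive law of A is the corresponding law of xor.
⊕-cong : ∀ {p p′ q q′} → p ≈ p′ → q ≈ q′ → p ⊕ q ≈ p′ ⊕ q′
⊕-cong {p} {p′} {q} {q′} h g = mk≈ λ n → ≡.trans (coeff-⊕ p q n)
  (≡.trans (cong₂ _xor_ (coeff-≈ h n) (coeff-≈ g n)) (≡.sym (coeff-⊕ p′ q′ n)))

⊕-congˡ : ∀ p {q q′} → q ≈ q′ → p ⊕ q ≈ p ⊕ q′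
⊕-congˡ p = ⊕-cong (≈-refl {p})

⊕-congʳ : ∀ {p p′} q → p ≈ p′ → p ⊕ q ≈ p′ ⊕ q
⊕-congʳ q h = ⊕-cong h (≈-refl {q})

⊕-comm : ∀ p q → p ⊕ q ≈ q ⊕ p
⊕-comm p q = mk≈ λ n → ≡.trans (coeff-⊕ p q n)
  (≡.trans (xor-comm (coeff p n) (coeff q n)) (≡.sym (coeff-⊕ q p n)))

⊕-assoc : ∀ p q r → (p ⊕ q) ⊕ r ≈ p ⊕ (q ⊕ r)
⊕-assoc p q r = mk≈ λ n → begin
  coeff ((p ⊕ q) ⊕ r) n                   ≡⟨ coeff-⊕ (p ⊕ q) r n ⟩
  coeff (p ⊕ q) n xor coeff r n           ≡⟨ cong (_xor coeff r n) (coeff-⊕ p q n) ⟩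
  (coeff p n xor coeff q n) xor coeff r n ≡⟨ xor-assoc (coeff p n) (coeff q n) (coeff r n) ⟩
  coeff p n xor (coeff q n xor coeff r n) ≡⟨ cong (coeff p n xor_) (coeff-⊕ q r n) ⟨
  coeff p n xor coeff (q ⊕ r) n           ≡⟨ coeff-⊕ p (q ⊕ r) n ⟨
  coeff (p ⊕ (q ⊕ r)) n                   ∎
  where open ≡.≡-Reasoning

⊕-identityʳ : ∀ p → p ⊕ [] ≈ p
⊕-identityʳ p = ⊕-comm p []

⊕-self : ∀ p → p ⊕ p ≈ []
⊕-self p = mk≈ λ n → ≡.trans (coeff-⊕ p p n) (xor-same (coeff p n))

⊕-interchange : ∀ p q r s → (p ⊕ q) ⊕ (r ⊕ s) ≈ (p ⊕ r) ⊕ (q ⊕ s)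
⊕-interchange p q r s = begin
  (p ⊕ q) ⊕ (r ⊕ s) ≈⟨ ⊕-assoc p q (r ⊕ s) ⟩
  p ⊕ (q ⊕ (r ⊕ s)) ≈⟨ ⊕-congˡ p (⊕-assoc q r s) ⟨
  p ⊕ ((q ⊕ r) ⊕ s) ≈⟨ ⊕-congˡ p (⊕-congʳ s (⊕-comm q r)) ⟩
  p ⊕ ((r ⊕ q) ⊕ s) ≈⟨ ⊕-congˡ p (⊕-assoc r q s) ⟩
  p ⊕ (r ⊕ (q ⊕ s)) ≈⟨ ⊕-assoc p r (q ⊕ s) ⟨
  (p ⊕ r) ⊕ (q ⊕ s) ∎
  where open ≈-Reasoning

-- Multiplication by a constant c ∈ F₂; by definition
-- (c ∷ p) ⊛ q = scale c q ⊕ t·(p ⊛ q).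
scale : Bool → Poly → Poly
scale c q = if c then q else []

scale-cong : ∀ c {q q′} → q ≈ q′ → scale c q ≈ scale c q′
scale-cong true  h = h
scale-cong false h = ≈-refl

scale-[] : ∀ c → scale c [] ≈ []
scale-[] true  = ≈-refl
scale-[] false = ≈-refl

scale-xor : ∀ c d q → scale (c xor d) q ≈ scale c q ⊕ scale d q
scale-xor false d    q = ≈-refl
scale-xor true false q = ≈-sym (⊕-identityʳ q)
scale-xor true true  q = ≈-sym (⊕-self q)

scale-⊛ : ∀ c q r → scale c q ⊛ r ≡ scale c (q ⊛ r)
scale-⊛ true  q r = refl
scale-⊛ false q r = refl

⊛-zeroˡ : ∀ {p} q → p ≈ [] → p ⊛ q ≈ []
⊛-zeroˡ {[]}    q h = ≈-refl
⊛-zeroˡ {c ∷ p} q h with coeff-≈ h 0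
... | refl = ≈-trans (∷-cong refl (⊛-zeroˡ q (∷-tail (≈-trans h (≈-sym false∷[]≈[])))))
                     false∷[]≈[]

⊛-congˡ : ∀ {p p′} q → p ≈ p′ → p ⊛ q ≈ p′ ⊛ q
⊛-congˡ {[]}    {p′}     q h = ≈-sym (⊛-zeroˡ q (≈-sym h))
⊛-congˡ {c ∷ p} {[]}     q h = ⊛-zeroˡ q h
⊛-congˡ {c ∷ p} {c′ ∷ p′} q h with coeff-≈ h 0
... | refl = ⊕-cong ≈-refl (∷-cong refl (⊛-congˡ q (∷-tail h)))

⊛-congʳ : ∀ p {q q′} → q ≈ q′ → p ⊛ q ≈ p ⊛ q′
⊛-congʳ []      h = ≈-refl
⊛-congʳ (c ∷ p) h = ⊕-cong (scale-cong c h) (∷-cong refl (⊛-congʳ p h))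

⊛-cong : ∀ {p p′ q q′} → p ≈ p′ → q ≈ q′ → p ⊛ q ≈ p′ ⊛ q′
⊛-cong {p′ = p′} {q} h g = ≈-trans (⊛-congˡ q h) (⊛-congʳ p′ g)

⊛-distribʳ : ∀ p q r → (p ⊕ q) ⊛ r ≈ p ⊛ r ⊕ q ⊛ r
⊛-distribʳ []      q       r = ≈-refl
⊛-distribʳ (c ∷ p) []      r = ≈-sym (⊕-identityʳ _)
⊛-distribʳ (c ∷ p) (d ∷ q) r =
  ≈-trans (⊕-cong (scale-xor c d r) (∷-cong refl (⊛-distribʳ p q r)))
          (⊕-interchange (scale c r) (scale d r) (false ∷ p ⊛ r) (false ∷ q ⊛ r))

⊛-assoc : ∀ p q r → (p ⊛ q) ⊛ r ≈ p ⊛ (q ⊛ r)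
⊛-assoc []      q r = ≈-refl
⊛-assoc (c ∷ p) q r =
  ≈-trans (⊛-distribʳ (scale c q) (false ∷ p ⊛ q) r)
          (⊕-cong (≈-reflexive (scale-⊛ c q r)) (∷-cong refl (⊛-assoc p q r)))

⊛-zeroʳ : ∀ p → p ⊛ [] ≈ []
⊛-zeroʳ []      = ≈-refl
⊛-zeroʳ (c ∷ p) = ≈-trans (⊕-cong (scale-[] c) (∷-cong refl (⊛-zeroʳ p))) false∷[]≈[]

⊛-∷ʳ : ∀ p c q → p ⊛ (c ∷ q) ≈ scale c p ⊕ (false ∷ p ⊛ q)
⊛-∷ʳ []      c q = ≈-sym (≈-trans (⊕-cong (scale-[] c) ≈-refl) false∷[]≈[])
⊛-∷ʳ (d ∷ p) c q = ≈-trans (⊕-cong ≈-refl (∷-cong refl (⊛-∷ʳ p c q))) (swap d c)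
  where
  swap : ∀ d c → scale d (c ∷ q) ⊕ (false ∷ (scale c p ⊕ (false ∷ p ⊛ q)))
               ≈ scale c (d ∷ p) ⊕ (false ∷ (scale d q ⊕ (false ∷ p ⊛ q)))
  swap false false = ≈-refl
  swap false true  = ≈-refl
  swap true  false = ≈-refl
  swap true  true  = ∷-cong refl (begin
    q ⊕ (p ⊕ (false ∷ p ⊛ q)) ≈⟨ ⊕-assoc q p _ ⟨
    (q ⊕ p) ⊕ (false ∷ p ⊛ q) ≈⟨ ⊕-cong (⊕-comm q p) ≈-refl ⟩
    (p ⊕ q) ⊕ (false ∷ p ⊛ q) ≈⟨ ⊕-assoc p q _ ⟩
    p ⊕ (q ⊕ (false ∷ p ⊛ q)) ∎)
    where open ≈-Reasoning

⊛-comm : ∀ p q → p ⊛ q ≈ q ⊛ p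
⊛-comm []      q = ≈-sym (⊛-zeroʳ q)
⊛-comm (c ∷ p) q = ≈-trans (⊕-cong ≈-refl (∷-cong refl (⊛-comm p q))) (≈-sym (⊛-∷ʳ q c p))

⊛-identityˡ : ∀ q → oneP ⊛ q ≈ q
⊛-identityˡ q = ≈-trans (⊕-cong ≈-refl false∷[]≈[]) (⊕-identityʳ q)

⊛-identityʳ : ∀ q → q ⊛ oneP ≈ q
⊛-identityʳ q = ≈-trans (⊛-comm q oneP) (⊛-identityˡ q)

⊛-distribˡ : ∀ p q r → p ⊛ (q ⊕ r) ≈ p ⊛ q ⊕ p ⊛ r
⊛-distribˡ p q r = begin
  p ⊛ (q ⊕ r)     ≈⟨ ⊛-comm p (q ⊕ r) ⟩
  (q ⊕ r) ⊛ p     ≈⟨ ⊛-distribʳ q r p ⟩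
  q ⊛ p ⊕ r ⊛ p   ≈⟨ ⊕-cong (⊛-comm q p) (⊛-comm r p) ⟩
  p ⊛ q ⊕ p ⊛ r   ∎
  where open ≈-Reasoning

F₂[t] : CommutativeRing _ _
F₂[t] = record
  { Carrier = Poly ; _≈_ = _≈_ ; _+_ = _⊕_ ; _*_ = _⊛_ ; -_ = -P_ ; 0# = [] ; 1# = oneP
  ; isCommutativeRing = record
    { isRing = record
      { +-isAbelianGroup = record
        { isGroup = record
          { isMonoid = record
            { isSemigroup = record
              { isMagma = record { isEquivalence = Setoid.isEquivalence ≈-setoid ; ∙-cong = ⊕-cong }
              ; assoc = ⊕-assoc }
            ; identity = (λ _ → ≈-refl) , ⊕-identityʳ }
          ; inverse = ⊕-self , ⊕-self
          ; ⁻¹-cong = λ h → h }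
        ; comm = ⊕-comm }
      ; *-cong = ⊛-cong
      ; *-assoc = ⊛-assoc
      ; *-identity = ⊛-identityˡ , ⊛-identityʳ
      ; distrib = ⊛-distribˡ , (λ r p q → ⊛-distribʳ p q r) }
    ; *-comm = ⊛-comm } }

-- Zero test on representations.  It lets the ring solver below discard
-- coefficients such as 1 + 1, so it also proves identities that only
-- hold in characteristic 2.
zero? : ∀ p → Maybe ([] ≈ p)
zero? []          = just ≈-refl
zero? (true ∷ p)  = nothing
zero? (false ∷ p) = Maybe.map (λ h → ≈-sym (≈-trans (∷-cong refl (≈-sym h)) false∷[]≈[])) (zero? p)

F₂[t]-solver : AlmostCommutativeRing _ _
F₂[t]-solver = fromCommutativeRing F₂[t] zero?

open import Algebra.Properties.CommutativeSemigroup (CommutativeRing.*-commutativeSemigroup F₂[t])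
  using () renaming (interchange to ⊛-medial; xy∙z≈xz∙y to ⊛-swap)

square-⊕ : ∀ x y → (x ⊕ y) ⊛ (x ⊕ y) ≈ x ⊛ x ⊕ y ⊛ y
square-⊕ = solve-∀ F₂[t]-solver

T U : Poly
T = tP
U = t+1P

^-cong : ∀ {p q} n → p ≈ q → p ^P n ≈ q ^P n
^-cong zero    h = ≈-refl
^-cong (suc n) h = ⊛-cong h (^-cong n h)

^-congʳ : ∀ p {m n} → m ≡ n → p ^P m ≈ p ^P n
^-congʳ p refl = ≈-refl

^-+ : ∀ p m n → p ^P (m + n) ≈ p ^P m ⊛ p ^P n
^-+ p zero    n = ≈-sym (⊛-identityˡ _)
^-+ p (suc m) n = ≈-trans (⊛-congʳ p (^-+ p m n)) (≈-sym (⊛-assoc p _ _))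

^-∸ : ∀ p {a k} → k ≤ a → p ^P (a ∸ k) ⊛ p ^P k ≈ p ^P a
^-∸ p {a} {k} k≤a = ≈-trans (≈-sym (^-+ p (a ∸ k) k)) (^-congʳ p (ℕₚ.m∸n+n≡m k≤a))

1^n : ∀ n → oneP ^P n ≈ oneP
1^n zero    = ≈-refl
1^n (suc n) = ≈-trans (⊛-identityˡ _) (1^n n)

frobenius : ∀ m p q → (p ⊕ q) ^P (2 ^ m) ≈ p ^P (2 ^ m) ⊕ q ^P (2 ^ m)
frobenius zero    p q = ≈-trans (⊛-identityʳ (p ⊕ q)) (≈-sym (⊕-cong (⊛-identityʳ p) (⊛-identityʳ q)))
frobenius (suc m) p q = begin
  (p ⊕ q) ^P (2 ^ m + (2 ^ m + 0))    ≈⟨ square (p ⊕ q) ⟩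
  (p ⊕ q) ^P (2 ^ m) ⊛ (p ⊕ q) ^P (2 ^ m)
      ≈⟨ ⊛-cong (frobenius m p q) (frobenius m p q) ⟩
  (p ^P (2 ^ m) ⊕ q ^P (2 ^ m)) ⊛ (p ^P (2 ^ m) ⊕ q ^P (2 ^ m))
      ≈⟨ square-⊕ (p ^P (2 ^ m)) (q ^P (2 ^ m)) ⟩
  p ^P (2 ^ m) ⊛ p ^P (2 ^ m) ⊕ q ^P (2 ^ m) ⊛ q ^P (2 ^ m)
      ≈⟨ ⊕-cong (square p) (square q) ⟨
  p ^P (2 ^ m + (2 ^ m + 0)) ⊕ q ^P (2 ^ m + (2 ^ m + 0)) ∎
  where
  open ≈-Reasoning
  square : ∀ x → x ^P (2 ^ m + (2 ^ m + 0)) ≈ x ^P (2 ^ m) ⊛ x ^P (2 ^ m)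
  square x = ≈-trans (^-+ x (2 ^ m) (2 ^ m + 0)) (⊛-congʳ (x ^P (2 ^ m)) (^-congʳ x (ℕₚ.+-identityʳ (2 ^ m))))

U^2^m : ∀ m → U ^P (2 ^ m) ≈ oneP ⊕ T ^P (2 ^ m)
U^2^m m = ≈-trans (frobenius m oneP T) (⊕-congʳ (T ^P (2 ^ m)) (1^n (2 ^ m)))

T⊛ : ∀ w → T ⊛ w ≈ (false ∷ w)
T⊛ w = ∷-cong refl (⊛-identityˡ w)

U⊛ : ∀ w → U ⊛ w ≈ w ⊕ (false ∷ w)
U⊛ w = ⊕-congˡ w (∷-cong refl (⊛-identityˡ w))

infix 4 _≃[_]_

-- p ≃[ a ] q means p ≡ q (mod tᵃ): the coefficients below degree a agree.
record _≃[_]_ (p : Poly) (a : ℕ) (q : Poly) : Set where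
  constructor mk≃
  field coeff-≃ : ∀ n → n < a → coeff p n ≡ coeff q n
open _≃[_]_ public

≈⇒≃ : ∀ {p q a} → p ≈ q → p ≃[ a ] q
≈⇒≃ h = mk≃ λ n _ → coeff-≈ h n

≃-trans : ∀ {p q r a} → p ≃[ a ] q → q ≃[ a ] r → p ≃[ a ] r
≃-trans h g = mk≃ λ n n<a → ≡.trans (coeff-≃ h n n<a) (coeff-≃ g n n<a)

≃-weaken : ∀ {p q a b} → b ≤ a → p ≃[ a ] q → p ≃[ b ] q
≃-weaken b≤a h = mk≃ λ n n<b → coeff-≃ h n (ℕₚ.<-≤-trans n<b b≤a)

≃-⊕ : ∀ {p p′ q q′ a} → p ≃[ a ] p′ → q ≃[ a ] q′ → p ⊕ q ≃[ a ] p′ ⊕ q′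
≃-⊕ {p} {p′} {q} {q′} h g = mk≃ λ n n<a → ≡.trans (coeff-⊕ p q n)
  (≡.trans (cong₂ _xor_ (coeff-≃ h n n<a) (coeff-≃ g n n<a)) (≡.sym (coeff-⊕ p′ q′ n)))

≃-∷ : ∀ {p q a} c → p ≃[ a ] q → (c ∷ p) ≃[ suc a ] (c ∷ q)
≃-∷ c h = mk≃ λ { zero _ → refl ; (suc n) (s≤s n<a) → coeff-≃ h n n<a }

⊛-≃ : ∀ s {p q a} → p ≃[ a ] q → s ⊛ p ≃[ a ] s ⊛ q
⊛-≃ s       {a = zero}  h = mk≃ λ _ ()
⊛-≃ []      {a = suc a} h = mk≃ λ _ _ → refl
⊛-≃ (c ∷ s) {a = suc a} h =
  ≃-⊕ (scale-≃ c) (≃-∷ false (⊛-≃ s (≃-weaken (ℕₚ.n≤1+n a) h)))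
  where
  scale-≃ : ∀ c → scale c _ ≃[ suc a ] scale c _
  scale-≃ true  = h
  scale-≃ false = mk≃ λ _ _ → refl

T^⊛≃0 : ∀ a w → T ^P a ⊛ w ≃[ a ] []
T^⊛≃0 zero    w = mk≃ λ _ ()
T^⊛≃0 (suc a) w = ≃-trans (≈⇒≃ (≈-trans (⊛-assoc T (T ^P a) w) (T⊛ _)))
                          (mk≃ λ { zero _ → refl ; (suc n) (s≤s n<a) → coeff-≃ (T^⊛≃0 a w) n n<a })

U-cancel : ∀ {p a} → U ⊛ p ≃[ a ] [] → p ≃[ a ] []
U-cancel {p} {a} h = mk≃ vanish
  where
  step : ∀ n → n < a → coeff p n xor coeff (false ∷ p) n ≡ false
  step n n<a = ≡.trans (≡.sym (coeff-⊕ p (false ∷ p) n)) (coeff-≃ (≃-trans (≈⇒≃ (≈-sym (U⊛ p))) h) n n<a)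
  vanish : ∀ n → n < a → coeff p n ≡ false
  vanish zero    n<a = ≡.trans (≡.sym (xor-identityʳ (coeff p 0))) (step 0 n<a)
  vanish (suc n) n<a = begin
    coeff p (suc n)                  ≡⟨ xor-identityʳ (coeff p (suc n)) ⟨
    coeff p (suc n) xor false        ≡⟨ cong (coeff p (suc n) xor_) (vanish n (ℕₚ.<-trans (ℕₚ.n<1+n n) n<a)) ⟨
    coeff p (suc n) xor coeff p n    ≡⟨ step (suc n) n<a ⟩
    false                            ∎
    where open ≡.≡-Reasoning

U^-cancel : ∀ k {p a} → U ^P k ⊛ p ≃[ a ] [] → p ≃[ a ] []
U^-cancel zero    {p} h = ≃-trans (≈⇒≃ (≈-sym (⊛-identityˡ p))) h
U^-cancel (suc k) {p} h = U^-cancel k (U-cancel (≃-trans (≈⇒≃ (≈-sym (⊛-assoc U (U ^P k) p))) h))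

drop : ℕ → Poly → Poly
drop zero    p       = p
drop (suc a) []      = []
drop (suc a) (c ∷ p) = drop a p

≃0⇒T^-factor : ∀ a p → p ≃[ a ] [] → p ≈ T ^P a ⊛ drop a p
≃0⇒T^-factor zero    p       h = ≈-sym (⊛-identityˡ p)
≃0⇒T^-factor (suc a) []      h = ≈-sym (⊛-zeroʳ (T ^P suc a))
≃0⇒T^-factor (suc a) (c ∷ p) h with coeff-≃ h 0 (s≤s z≤n)
... | refl = begin
  false ∷ p                      ≈⟨ ∷-cong refl (≃0⇒T^-factor a p (mk≃ λ n n<a → coeff-≃ h (suc n) (s≤s n<a))) ⟩
  false ∷ (T ^P a ⊛ drop a p)    ≈⟨ T⊛ _ ⟨
  T ⊛ (T ^P a ⊛ drop a p)        ≈⟨ ⊛-assoc T (T ^P a) _ ⟨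
  T ^P suc a ⊛ drop a p          ∎
  where open ≈-Reasoning

record Deg≤ (d : ℕ) (p : Poly) : Set where
  constructor mkDeg
  field coeff-above : ∀ n → d < n → coeff p n ≡ false
open Deg≤ public

Deg-cong : ∀ {d p q} → p ≈ q → Deg≤ d p → Deg≤ d q
Deg-cong h g = mkDeg λ n d<n → ≡.trans (≡.sym (coeff-≈ h n)) (coeff-above g n d<n)

Deg-mono : ∀ {d e p} → d ≤ e → Deg≤ d p → Deg≤ e p
Deg-mono d≤e g = mkDeg λ n e<n → coeff-above g n (ℕₚ.≤-<-trans d≤e e<n)

Deg-[] : ∀ d → Deg≤ d []
Deg-[] d = mkDeg λ _ _ → refl

Deg-const : ∀ c → Deg≤ 0 (c ∷ [])
Deg-const c = mkDeg λ { (suc n) _ → refl }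

Deg-⊕ : ∀ {d p q} → Deg≤ d p → Deg≤ d q → Deg≤ d (p ⊕ q)
Deg-⊕ {p = p} {q} g h = mkDeg λ n d<n →
  ≡.trans (coeff-⊕ p q n) (cong₂ _xor_ (coeff-above g n d<n) (coeff-above h n d<n))

Deg-∷ : ∀ {d p} c → Deg≤ d p → Deg≤ (suc d) (c ∷ p)
Deg-∷ c g = mkDeg λ { (suc n) (s≤s d<n) → coeff-above g n d<n }

Deg-tail : ∀ {d p c} → Deg≤ (suc d) (c ∷ p) → Deg≤ d p
Deg-tail g = mkDeg λ n d<n → coeff-above g (suc n) (s≤s d<n)

Deg0-tail : ∀ {p c} → Deg≤ 0 (c ∷ p) → p ≈ []
Deg0-tail g = mk≈ λ n → coeff-above g (suc n) (s≤s z≤n)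

Deg-⊛ : ∀ {d e p q} → Deg≤ d p → Deg≤ e q → Deg≤ (d + e) (p ⊛ q)
Deg-⊛ {p = []}              g h = Deg-[] _
Deg-⊛ {zero}  {p = c ∷ p} {q} g h = Deg-⊕ (scale-Deg c) (Deg-cong (≈-sym tail≈[]) (Deg-[] _))
  where
  scale-Deg : ∀ c → Deg≤ _ (scale c q)
  scale-Deg true  = h
  scale-Deg false = Deg-[] _
  tail≈[] : (false ∷ p ⊛ q) ≈ []
  tail≈[] = ≈-trans (∷-cong refl (⊛-zeroˡ q (Deg0-tail g))) false∷[]≈[]
Deg-⊛ {suc d} {e} {c ∷ p} {q} g h =
  Deg-⊕ (scale-Deg c) (Deg-∷ false (Deg-⊛ {d} {e} {p} {q} (Deg-tail g) h))
  where
  scale-Deg : ∀ c → Deg≤ (suc d + e) (scale c q)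
  scale-Deg true  = Deg-mono (ℕₚ.m≤n+m e (suc d)) h
  scale-Deg false = Deg-[] _

Deg-^ : ∀ {d p} k → Deg≤ d p → Deg≤ (k * d) (p ^P k)
Deg-^ zero    g = Deg-const true
Deg-^ (suc k) g = Deg-⊛ g (Deg-^ k g)

Deg-T : Deg≤ 1 T
Deg-T = mkDeg λ { (suc (suc n)) _ → refl ; (suc zero) (s≤s ()) }

Deg-U : Deg≤ 1 U
Deg-U = mkDeg λ { (suc (suc n)) _ → refl ; (suc zero) (s≤s ()) }

Deg-T^ : ∀ k → Deg≤ k (T ^P k)
Deg-T^ k = ≡.subst (λ d → Deg≤ d (T ^P k)) (ℕₚ.*-identityʳ k) (Deg-^ k Deg-T)

Deg-U^ : ∀ k → Deg≤ k (U ^P k)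
Deg-U^ k = ≡.subst (λ d → Deg≤ d (U ^P k)) (ℕₚ.*-identityʳ k) (Deg-^ k Deg-U)

Deg-drop : ∀ a {d} p → Deg≤ (a + d) p → Deg≤ d (drop a p)
Deg-drop zero    p       g = g
Deg-drop (suc a) []      g = Deg-[] _
Deg-drop (suc a) (c ∷ p) g = Deg-drop a p (Deg-tail g)

Deg≤∧≃0⇒≈0 : ∀ {d p} → Deg≤ d p → p ≃[ suc d ] [] → p ≈ []
Deg≤∧≃0⇒≈0 {d} {p} g h = mk≈ λ n → case (ℕₚ.≤-<-connex (suc n) (suc d))
  where
  case : ∀ {n} → suc n ≤ suc d ⊎ suc d < suc n → coeff p n ≡ false
  case {n} (inj₁ n<d+1) = coeff-≃ h n n<d+1
  case {n} (inj₂ d<n)   = coeff-above g n (ℕₚ.≤-pred d<n)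

infixl 8 _⟦_⟧
_⟦_⟧ : Poly → Poly → Poly
[]      ⟦ x ⟧ = []
(c ∷ p) ⟦ x ⟧ = (c ∷ []) ⊕ x ⊛ p ⟦ x ⟧

⟦⟧-const : ∀ c x → (c ∷ []) ⟦ x ⟧ ≈ (c ∷ [])
⟦⟧-const c x = ≈-trans (⊕-congˡ (c ∷ []) (⊛-zeroʳ x)) (⊕-identityʳ (c ∷ []))

⟦⟧-zero : ∀ {p} x → p ≈ [] → p ⟦ x ⟧ ≈ []
⟦⟧-zero {[]}    x h = ≈-refl
⟦⟧-zero {c ∷ p} x h with coeff-≈ h 0
... | refl = ≈-trans (⊕-congˡ (false ∷ []) (≈-trans (⊛-congʳ x (⟦⟧-zero x (∷-tail (≈-trans h (≈-sym false∷[]≈[])))))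
                                                    (⊛-zeroʳ x)))
                     (≈-trans (⊕-identityʳ (false ∷ [])) false∷[]≈[])

⟦⟧-congˡ : ∀ {p q} x → p ≈ q → p ⟦ x ⟧ ≈ q ⟦ x ⟧
⟦⟧-congˡ {[]}    {q}     x h = ≈-sym (⟦⟧-zero x (≈-sym h))
⟦⟧-congˡ {c ∷ p} {[]}    x h = ⟦⟧-zero x h
⟦⟧-congˡ {c ∷ p} {d ∷ q} x h with coeff-≈ h 0
... | refl = ⊕-congˡ (c ∷ []) (⊛-congʳ x (⟦⟧-congˡ x (∷-tail h)))

⟦⟧-congʳ : ∀ p {x y} → x ≈ y → p ⟦ x ⟧ ≈ p ⟦ y ⟧
⟦⟧-congʳ []      h = ≈-refl
⟦⟧-congʳ (c ∷ p) h = ⊕-congˡ (c ∷ []) (⊛-cong h (⟦⟧-congʳ p h))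

⟦⟧-⊕ : ∀ p q x → (p ⊕ q) ⟦ x ⟧ ≈ p ⟦ x ⟧ ⊕ q ⟦ x ⟧
⟦⟧-⊕ []      q       x = ≈-refl
⟦⟧-⊕ (c ∷ p) []      x = ≈-sym (⊕-identityʳ _)
⟦⟧-⊕ (c ∷ p) (d ∷ q) x = begin
  (c ∷ []) ⊕ (d ∷ []) ⊕ x ⊛ (p ⊕ q) ⟦ x ⟧
    ≈⟨ ⊕-congˡ ((c ∷ []) ⊕ (d ∷ [])) (⊛-congʳ x (⟦⟧-⊕ p q x)) ⟩
  (c ∷ []) ⊕ (d ∷ []) ⊕ x ⊛ (p ⟦ x ⟧ ⊕ q ⟦ x ⟧)
    ≈⟨ regroup (c ∷ []) (d ∷ []) x (p ⟦ x ⟧) (q ⟦ x ⟧) ⟩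
  ((c ∷ []) ⊕ x ⊛ p ⟦ x ⟧) ⊕ ((d ∷ []) ⊕ x ⊛ q ⟦ x ⟧) ∎
  where
  open ≈-Reasoning
  regroup : ∀ k l x P Q → k ⊕ l ⊕ x ⊛ (P ⊕ Q) ≈ (k ⊕ x ⊛ P) ⊕ (l ⊕ x ⊛ Q)
  regroup = solve-∀ F₂[t]-solver

const-⊛ : ∀ c w → (c ∷ []) ⊛ w ≈ scale c w
const-⊛ c w = ≈-trans (⊕-congˡ (scale c w) false∷[]≈[]) (⊕-identityʳ (scale c w))

⟦⟧-⊛ : ∀ p q x → (p ⊛ q) ⟦ x ⟧ ≈ p ⟦ x ⟧ ⊛ q ⟦ x ⟧
⟦⟧-⊛ []      q x = ≈-refl
⟦⟧-⊛ (c ∷ p) q x = begin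
  (scale c q ⊕ (false ∷ p ⊛ q)) ⟦ x ⟧
    ≈⟨ ⟦⟧-⊕ (scale c q) (false ∷ p ⊛ q) x ⟩
  scale c q ⟦ x ⟧ ⊕ ((false ∷ []) ⊕ x ⊛ (p ⊛ q) ⟦ x ⟧)
    ≈⟨ ⊕-cong (≈-trans (≈-reflexive (scale-⟦⟧ c)) (≈-sym (const-⊛ c (q ⟦ x ⟧))))
              (⊕-congʳ (x ⊛ (p ⊛ q) ⟦ x ⟧) false∷[]≈[]) ⟩
  (c ∷ []) ⊛ q ⟦ x ⟧ ⊕ x ⊛ (p ⊛ q) ⟦ x ⟧
    ≈⟨ ⊕-congˡ ((c ∷ []) ⊛ q ⟦ x ⟧) (⊛-congʳ x (⟦⟧-⊛ p q x)) ⟩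
  (c ∷ []) ⊛ q ⟦ x ⟧ ⊕ x ⊛ (p ⟦ x ⟧ ⊛ q ⟦ x ⟧)
    ≈⟨ factor (c ∷ []) x (p ⟦ x ⟧) (q ⟦ x ⟧) ⟩
  ((c ∷ []) ⊕ x ⊛ p ⟦ x ⟧) ⊛ q ⟦ x ⟧ ∎
  where
  open ≈-Reasoning
  scale-⟦⟧ : ∀ c → scale c q ⟦ x ⟧ ≡ scale c (q ⟦ x ⟧)
  scale-⟦⟧ true  = refl
  scale-⟦⟧ false = refl
  factor : ∀ k x P Q → k ⊛ Q ⊕ x ⊛ (P ⊛ Q) ≈ (k ⊕ x ⊛ P) ⊛ Q
  factor = solve-∀ F₂[t]-solver

⟦⟧-^ : ∀ p k x → (p ^P k) ⟦ x ⟧ ≈ (p ⟦ x ⟧) ^P k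
⟦⟧-^ p zero    x = ⟦⟧-const true x
⟦⟧-^ p (suc k) x = ≈-trans (⟦⟧-⊛ p (p ^P k) x) (⊛-congʳ (p ⟦ x ⟧) (⟦⟧-^ p k x))

⟦⟧-∘ : ∀ p x y → p ⟦ x ⟧ ⟦ y ⟧ ≈ p ⟦ x ⟦ y ⟧ ⟧
⟦⟧-∘ []      x y = ≈-refl
⟦⟧-∘ (c ∷ p) x y = begin
  ((c ∷ []) ⊕ x ⊛ p ⟦ x ⟧) ⟦ y ⟧          ≈⟨ ⟦⟧-⊕ (c ∷ []) (x ⊛ p ⟦ x ⟧) y ⟩
  (c ∷ []) ⟦ y ⟧ ⊕ (x ⊛ p ⟦ x ⟧) ⟦ y ⟧    ≈⟨ ⊕-cong (⟦⟧-const c y) (⟦⟧-⊛ x (p ⟦ x ⟧) y) ⟩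
  (c ∷ []) ⊕ x ⟦ y ⟧ ⊛ p ⟦ x ⟧ ⟦ y ⟧      ≈⟨ ⊕-congˡ (c ∷ []) (⊛-congʳ (x ⟦ y ⟧) (⟦⟧-∘ p x y)) ⟩
  (c ∷ []) ⊕ x ⟦ y ⟧ ⊛ p ⟦ x ⟦ y ⟧ ⟧      ∎
  where open ≈-Reasoning

⟦T⟧ : ∀ p → p ⟦ T ⟧ ≈ p
⟦T⟧ []      = ≈-refl
⟦T⟧ (c ∷ p) = ≈-trans (⊕-congˡ (c ∷ []) (≈-trans (T⊛ _) (∷-cong refl (⟦T⟧ p))))
                      (∷-cong (xor-identityʳ c) ≈-refl)

Deg-⟦⟧ : ∀ {d x} p → Deg≤ 1 x → Deg≤ d p → Deg≤ d (p ⟦ x ⟧)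
Deg-⟦⟧         []      hx g = Deg-[] _
Deg-⟦⟧ {zero}  {x} (c ∷ p) hx g =
  Deg-cong (≈-sym (≈-trans (⊕-congˡ (c ∷ []) (≈-trans (⊛-congʳ x (⟦⟧-zero x (Deg0-tail g))) (⊛-zeroʳ x)))
                           (⊕-identityʳ (c ∷ []))))
           (Deg-const c)
Deg-⟦⟧ {suc d} (c ∷ p) hx g = Deg-⊕ (Deg-mono z≤n (Deg-const c)) (Deg-⊛ hx (Deg-⟦⟧ p hx (Deg-tail g)))

σ : Poly → Poly
σ p = p ⟦ U ⟧

σ-T : σ T ≈ U
σ-T = mk≈ λ { 0 → refl ; 1 → refl ; 2 → refl ; (suc (suc (suc n))) → refl }

σ-U : σ U ≈ T
σ-U = mk≈ λ { 0 → refl ; 1 → refl ; 2 → refl ; (suc (suc (suc n))) → refl }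

σ-T^ : ∀ k → σ (T ^P k) ≈ U ^P k
σ-T^ k = ≈-trans (⟦⟧-^ T k U) (^-cong k σ-T)

σ-U^ : ∀ k → σ (U ^P k) ≈ T ^P k
σ-U^ k = ≈-trans (⟦⟧-^ U k U) (^-cong k σ-U)

σ-involutive : ∀ p → σ (σ p) ≈ p
σ-involutive p = ≈-trans (⟦⟧-∘ p U U) (≈-trans (⟦⟧-congʳ p σ-U) (⟦T⟧ p))

Deg-σ : ∀ {d} p → Deg≤ d p → Deg≤ d (σ p)
Deg-σ p = Deg-⟦⟧ p Deg-U

odd : ℕ → Bool
odd zero    = false
odd (suc n) = not (odd n)

odd-+ : ∀ m n → odd (m + n) ≡ odd m xor odd n
odd-+ zero    n = refl
odd-+ (suc m) n = ≡.trans (cong not (odd-+ m n)) (not-distribˡ-xor (odd m) (odd n))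

odd-* : ∀ m n → odd (m * n) ≡ odd m ∧ odd n
odd-* zero    n = refl
odd-* (suc m) n = ≡.trans (odd-+ n (m * n)) (≡.trans (cong (odd n xor_) (odd-* m n)) (absorb (odd m) (odd n)))
  where
  absorb : ∀ x y → y xor (x ∧ y) ≡ not x ∧ y
  absorb false y = xor-identityʳ y
  absorb true  y = xor-same y

toF₂≡odd : ∀ n → toF₂ n ≡ odd n
toF₂≡odd zero          = refl
toF₂≡odd (suc zero)    = refl
toF₂≡odd (suc (suc n)) = begin
  toF₂ (2 + n)        ≡⟨ cong (λ k → (k % 2) ≡ᵇ 1) (ℕₚ.+-comm 2 n) ⟩
  toF₂ (n + 2)        ≡⟨ cong (_≡ᵇ 1) (Data.Nat.DivMod.[m+n]%n≡m%n n 2) ⟩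
  toF₂ n              ≡⟨ toF₂≡odd n ⟩
  odd n               ≡⟨ not-involutive (odd n) ⟨
  not (not (odd n))   ∎
  where open ≡.≡-Reasoning

Σ₂ : ℕ → (ℕ → Bool) → Bool
Σ₂ zero    h = false
Σ₂ (suc n) h = Σ₂ n h xor h n

Σ₂-cong : ∀ n {h h′} → (∀ i → h i ≡ h′ i) → Σ₂ n h ≡ Σ₂ n h′
Σ₂-cong zero    e = refl
Σ₂-cong (suc n) e = cong₂ _xor_ (Σ₂-cong n e) (e n)

Σ₂-false : ∀ n → Σ₂ n (λ _ → false) ≡ false
Σ₂-false zero    = refl
Σ₂-false (suc n) = ≡.trans (xor-identityʳ _) (Σ₂-false n)

Σ₂-suc : ∀ n h → Σ₂ (suc n) h ≡ h 0 xor Σ₂ n (λ i → h (suc i))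
Σ₂-suc zero    h = ≡.sym (xor-identityʳ (h 0))
Σ₂-suc (suc n) h = ≡.trans (cong (_xor h (suc n)) (Σ₂-suc n h)) (xor-assoc (h 0) _ _)

toF₂-sumℕ : ∀ n g → toF₂ (sumℕ n g) ≡ Σ₂ n (λ i → odd (g i))
toF₂-sumℕ n g = ≡.trans (toF₂≡odd (sumℕ n g)) (odd-sum n)
  where
  odd-sum : ∀ n → odd (sumℕ n g) ≡ Σ₂ n (λ i → odd (g i))
  odd-sum zero    = refl
  odd-sum (suc n) = ≡.trans (odd-+ (sumℕ n g) (g n)) (cong (_xor odd (g n)) (odd-sum n))

coeff-scale : ∀ c {q n} → coeff (scale c q) n ≡ c ∧ coeff q n
coeff-scale true  = refl
coeff-scale false = refl

coeff-⊛ : ∀ p q k → coeff (p ⊛ q) k ≡ Σ₂ (suc k) (λ i → coeff p i ∧ coeff q (k ∸ i))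
coeff-⊛ []      q k       = ≡.sym (Σ₂-false (suc k))
coeff-⊛ (c ∷ p) q zero    = ≡.trans (coeff-⊕ (scale c q) (false ∷ p ⊛ q) 0)
                                    (≡.trans (xor-identityʳ _) (coeff-scale c))
coeff-⊛ (c ∷ p) q (suc k) = begin
  coeff (scale c q ⊕ (false ∷ p ⊛ q)) (suc k)
    ≡⟨ coeff-⊕ (scale c q) (false ∷ p ⊛ q) (suc k) ⟩
  coeff (scale c q) (suc k) xor coeff (p ⊛ q) k
    ≡⟨ cong₂ _xor_ (coeff-scale c) (coeff-⊛ p q k) ⟩
  (c ∧ coeff q (suc k)) xor Σ₂ (suc k) (λ i → coeff p i ∧ coeff q (k ∸ i))
    ≡⟨ Σ₂-suc (suc k) (λ i → coeff (c ∷ p) i ∧ coeff q (suc k ∸ i)) ⟨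
  Σ₂ (suc (suc k)) (λ i → coeff (c ∷ p) i ∧ coeff q (suc k ∸ i)) ∎
  where open ≡.≡-Reasoning

True⇒≡true : ∀ {b} → True b → b ≡ true
True⇒≡true {true} _ = refl

≡ᵇ-≢ : ∀ {m n} → m ≢ n → (m ≡ᵇ n) ≡ false
≡ᵇ-≢ {m} {n} m≢n with m ≡ᵇ n in eq
... | false = refl
... | true  = ⊥-elim (m≢n (ℕₚ.≡ᵇ⇒≡ m n (≡.subst True (≡.sym eq) _)))

coeff-T^ : ∀ k j → coeff (T ^P k) j ≡ (k ≡ᵇ j)
coeff-T^ zero    zero    = refl
coeff-T^ zero    (suc j) = refl
coeff-T^ (suc k) zero    = coeff-≈ (T⊛ (T ^P k)) 0
coeff-T^ (suc k) (suc j) = ≡.trans (coeff-≈ (T⊛ (T ^P k)) (suc j)) (coeff-T^ k j)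

coeff-U^ : ∀ n k → coeff (U ^P n) k ≡ odd (n C k)
coeff-U^ zero    zero    = refl
coeff-U^ zero    (suc k) = refl
coeff-U^ (suc n) zero    = begin
  coeff (U ⊛ U ^P n) 0                 ≡⟨ coeff-≈ (U⊛ (U ^P n)) 0 ⟩
  coeff (U ^P n ⊕ (false ∷ U ^P n)) 0  ≡⟨ coeff-⊕ (U ^P n) _ 0 ⟩
  coeff (U ^P n) 0 xor false           ≡⟨ xor-identityʳ _ ⟩
  coeff (U ^P n) 0                     ≡⟨ coeff-U^ n 0 ⟩
  true                                 ∎
  where open ≡.≡-Reasoning
coeff-U^ (suc n) (suc k) = begin
  coeff (U ⊛ U ^P n) (suc k)                    ≡⟨ coeff-≈ (U⊛ (U ^P n)) (suc k) ⟩
  coeff (U ^P n ⊕ (false ∷ U ^P n)) (suc k)     ≡⟨ coeff-⊕ (U ^P n) _ (suc k) ⟩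
  coeff (U ^P n) (suc k) xor coeff (U ^P n) k   ≡⟨ cong₂ _xor_ (coeff-U^ n (suc k)) (coeff-U^ n k) ⟩
  odd (n C suc k) xor odd (n C k)               ≡⟨ xor-comm (odd (n C suc k)) (odd (n C k)) ⟩
  odd (n C k) xor odd (n C suc k)               ≡⟨ odd-+ (n C k) (n C suc k) ⟨
  odd (n C k + n C suc k)                       ≡⟨ cong odd (nCk+nC[k+1]≡[n+1]C[k+1] n k) ⟩
  odd (suc n C suc k)                           ∎
  where open ≡.≡-Reasoning

-- The numerator of S₁(c) = ((t + 1)ᶜ + tᶜ) / (tᶜ (t + 1)ᶜ).
S₁-num : ℕ → Poly
S₁-num c = U ^P c ⊕ T ^P c

coeff-U^-≤ : ∀ r i → coeff (U ^P r) i ≡ (i ≤ᵇ r) ∧ odd (r C i)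
coeff-U^-≤ r i = ≡.trans (coeff-U^ r i) support
  where
  -- r C i is by definition 0 unless i ≤ r
  support : odd (r C i) ≡ (i ≤ᵇ r) ∧ odd (r C i)
  support with i ≤ᵇ r
  ... | true  = refl
  ... | false = refl

-- For c ≥ 1 the leading coefficients of (t + 1)ᶜ and tᶜ cancel.
coeff-S₁-num : ∀ c j → coeff (S₁-num (suc c)) j ≡ (j ≤ᵇ c) ∧ odd (suc c C j)
coeff-S₁-num c j = ≡.trans (coeff-⊕ (U ^P suc c) (T ^P suc c) j)
  (≡.trans (cong₂ _xor_ (coeff-U^ (suc c) j) (coeff-T^ (suc c) j)) (cancel-top j))
  where
  cancel-top : ∀ j → odd (suc c C j) xor (suc c ≡ᵇ j) ≡ (j ≤ᵇ c) ∧ odd (suc c C j)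
  cancel-top j with j ≤ᵇ c | ℕₚ.≤ᵇ-reflects-≤ j c
  ... | true  | ofʸ j≤c
      rewrite ≡ᵇ-≢ {suc c} {j} (λ { refl → ℕₚ.<-irrefl refl j≤c }) = xor-identityʳ _
  ... | false | ofⁿ j≰c with ℕₚ.m≤n⇒m<n∨m≡n (ℕₚ.≰⇒> j≰c)
  ...   | inj₁ 1+c<j rewrite ≡ᵇ-≢ {suc c} {j} (λ { refl → ℕₚ.<-irrefl refl 1+c<j })
                           | k>n⇒nCk≡0 1+c<j = refl
  ...   | inj₂ refl  rewrite nCn≡1 (suc c) | True⇒≡true (ℕₚ.≡⇒≡ᵇ c c refl) = refl

odd-if : ∀ P Q x y → odd (if P ∧ Q then x * y else 0) ≡ (P ∧ odd x) ∧ (Q ∧ odd y)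
odd-if true  true  x y = odd-* x y
odd-if true  false x y = ≡.sym (∧-zeroʳ (odd x))
odd-if false Q     x y = refl

binomial-sum≡coeff : ∀ r c → 0 < c → ∀ k →
  toF₂ (sumℕ (suc k) λ i → if (i ≤ᵇ r) ∧ ((k ∸ i) ≤ᵇ (c ∸ 1)) then (r C i) * (c C (k ∸ i)) else 0)
  ≡ coeff (U ^P r ⊛ S₁-num c) k
binomial-sum≡coeff r (suc c) _ k = begin
  toF₂ (sumℕ (suc k) g)
    ≡⟨ toF₂-sumℕ (suc k) g ⟩
  Σ₂ (suc k) (λ i → odd (g i))
    ≡⟨ Σ₂-cong (suc k) (λ i → odd-if (i ≤ᵇ r) ((k ∸ i) ≤ᵇ c) (r C i) (suc c C (k ∸ i))) ⟩
  Σ₂ (suc k) (λ i → ((i ≤ᵇ r) ∧ odd (r C i)) ∧ (((k ∸ i) ≤ᵇ c) ∧ odd (suc c C (k ∸ i))))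
    ≡⟨ Σ₂-cong (suc k) (λ i → cong₂ _∧_ (coeff-U^-≤ r i) (coeff-S₁-num c (k ∸ i))) ⟨
  Σ₂ (suc k) (λ i → coeff (U ^P r) i ∧ coeff (S₁-num (suc c)) (k ∸ i))
    ≡⟨ coeff-⊛ (U ^P r) (S₁-num (suc c)) k ⟨
  coeff (U ^P r ⊛ S₁-num (suc c)) k ∎
  where
  open ≡.≡-Reasoning
  g : ℕ → ℕ
  g i = if (i ≤ᵇ r) ∧ ((k ∸ i) ≤ᵇ c) then (r C i) * (suc c C (k ∸ i)) else 0

Σₚ : ℕ → (ℕ → Poly) → Poly
Σₚ zero    g = []
Σₚ (suc n) g = Σₚ n g ⊕ g n

Σₚ-cong : ∀ n {g h} → (∀ k → k < n → g k ≈ h k) → Σₚ n g ≈ Σₚ n h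
Σₚ-cong zero    e = ≈-refl
Σₚ-cong (suc n) e = ⊕-cong (Σₚ-cong n (λ k k<n → e k (ℕₚ.m<n⇒m<1+n k<n))) (e n (ℕₚ.n<1+n n))

Σₚ-⊕ : ∀ n g h → Σₚ n (λ k → g k ⊕ h k) ≈ Σₚ n g ⊕ Σₚ n h
Σₚ-⊕ zero    g h = ≈-sym (⊕-identityʳ [])
Σₚ-⊕ (suc n) g h = ≈-trans (⊕-congʳ (g n ⊕ h n) (Σₚ-⊕ n g h)) (⊕-interchange (Σₚ n g) (Σₚ n h) (g n) (h n))

Σₚ-⊛ : ∀ n s g → Σₚ n (λ k → s ⊛ g k) ≈ s ⊛ Σₚ n g
Σₚ-⊛ zero    s g = ≈-sym (⊛-zeroʳ s)
Σₚ-⊛ (suc n) s g = ≈-trans (⊕-congʳ (s ⊛ g n) (Σₚ-⊛ n s g)) (≈-sym (⊛-distribˡ s (Σₚ n g) (g n)))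

σ-Σₚ : ∀ n g → σ (Σₚ n g) ≈ Σₚ n (λ k → σ (g k))
σ-Σₚ zero    g = ≈-refl
σ-Σₚ (suc n) g = ≈-trans (⟦⟧-⊕ (Σₚ n g) (g n) U) (⊕-congʳ (σ (g n)) (σ-Σₚ n g))

poly : ℕ → (ℕ → Bool) → Poly
poly n f = Σₚ n (λ k → scale (f k) (T ^P k))

coeff-poly-≥ : ∀ n f j → n ≤ j → coeff (poly n f) j ≡ false
coeff-poly-≥ zero    f j n≤j = refl
coeff-poly-≥ (suc n) f j n<j rewrite coeff-⊕ (poly n f) (scale (f n) (T ^P n)) j
                                  | coeff-poly-≥ n f j (ℕₚ.<⇒≤ n<j)
                                  | coeff-scale (f n) {T ^P n} {j}
                                  | coeff-T^ n j
                                  | ≡ᵇ-≢ {n} {j} (λ { refl → ℕₚ.<-irrefl refl n<j }) = ∧-zeroʳ (f n)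

coeff-poly-< : ∀ n f j → j < n → coeff (poly n f) j ≡ f j
coeff-poly-< (suc n) f j j<1+n rewrite coeff-⊕ (poly n f) (scale (f n) (T ^P n)) j
                                    | coeff-scale (f n) {T ^P n} {j}
                                    | coeff-T^ n j
  with ℕₚ.m≤n⇒m<n∨m≡n (ℕₚ.≤-pred j<1+n)
... | inj₁ j<n rewrite coeff-poly-< n f j j<n | ≡ᵇ-≢ {n} {j} (λ { refl → ℕₚ.<-irrefl refl j<n })
                     | ∧-zeroʳ (f n) = xor-identityʳ (f j)
... | inj₂ refl rewrite coeff-poly-≥ n f n ℕₚ.≤-refl | True⇒≡true (ℕₚ.≡⇒≡ᵇ n n refl) = ∧-identityʳ (f n)

Deg-poly : ∀ n f → Deg≤ n (poly (suc n) f)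
Deg-poly n f = mkDeg λ j n<j → coeff-poly-≥ (suc n) f j n<j

⊕≈0⇒≈ : ∀ {x y} → x ⊕ y ≈ [] → x ≈ y
⊕≈0⇒≈ {x} {y} h = begin
  x             ≈⟨ add-twice x y ⟨
  (x ⊕ y) ⊕ y   ≈⟨ ⊕-congʳ y h ⟩
  [] ⊕ y        ≈⟨ ≈-refl ⟩
  y             ∎
  where
  open ≈-Reasoning
  add-twice : ∀ x y → (x ⊕ y) ⊕ y ≈ x
  add-twice = solve-∀ F₂[t]-solver

-- A σ-invariant polynomial D of degree < 2a with D ≡ 0 (mod tᵃ) is zero:
-- writing D = tᵃ D₁ gives D = σ D = (t + 1)ᵃ σD₁, so σD₁ ≡ 0 (mod tᵃ)
-- because t + 1 is a unit mod tᵃ; as deg σD₁ < a, σD₁ = 0 and D = 0.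
σ-invariant-vanishing : ∀ a′ D → σ D ≈ D → Deg≤ (suc a′ + a′) D → D ≃[ suc a′ ] [] → D ≈ []
σ-invariant-vanishing a′ D σD≈D deg D≃0 = begin
  D               ≈⟨ σD≈D ⟨
  σ D             ≈⟨ σD≈U^σD₁ ⟩
  U ^P a ⊛ σ D₁   ≈⟨ ⊛-congʳ (U ^P a) σD₁≈0 ⟩
  U ^P a ⊛ []     ≈⟨ ⊛-zeroʳ (U ^P a) ⟩
  []              ∎
  where
  open ≈-Reasoning
  a : ℕ
  a = suc a′
  D₁ : Poly
  D₁ = drop a D
  σD≈U^σD₁ : σ D ≈ U ^P a ⊛ σ D₁
  σD≈U^σD₁ = ≈-trans (⟦⟧-congˡ U (≃0⇒T^-factor a D D≃0))
                     (≈-trans (⟦⟧-⊛ (T ^P a) D₁ U) (⊛-congˡ (σ D₁) (σ-T^ a)))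
  σD₁≈0 : σ D₁ ≈ []
  σD₁≈0 = Deg≤∧≃0⇒≈0 (Deg-σ D₁ (Deg-drop a D deg))
    (U^-cancel a (≃-trans (≈⇒≃ (≈-trans (≈-sym σD≈U^σD₁) σD≈D)) D≃0))

-- Let E be σ-invariant of degree ≤ a and let A have
-- degree < a with (t + 1)ᵃ A ≡ E (mod tᵃ).  Then (t + 1)ᵃ A + tᵃ σA = E:
-- the difference D is σ-invariant, of degree < 2a, and ≡ 0 (mod tᵃ).
symmetric-completion : ∀ a′ A E → σ E ≈ E → Deg≤ (suc a′) E → Deg≤ a′ A →
  U ^P suc a′ ⊛ A ≃[ suc a′ ] E → U ^P suc a′ ⊛ A ⊕ T ^P suc a′ ⊛ σ A ≈ E
symmetric-completion a′ A E σE≈E degE degA U^A≃E =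
  ⊕≈0⇒≈ (σ-invariant-vanishing a′ D σD≈D degD D≃0)
  where
  a : ℕ
  a = suc a′
  D : Poly
  D = U ^P a ⊛ A ⊕ T ^P a ⊛ σ A ⊕ E
  σD≈D : σ D ≈ D
  σD≈D = begin
    σ D ≈⟨ ≈-trans (⟦⟧-⊕ (U ^P a ⊛ A ⊕ T ^P a ⊛ σ A) E U) (⊕-congʳ (σ E) (⟦⟧-⊕ (U ^P a ⊛ A) (T ^P a ⊛ σ A) U)) ⟩
    σ (U ^P a ⊛ A) ⊕ σ (T ^P a ⊛ σ A) ⊕ σ E
      ≈⟨ ⊕-cong (⊕-cong (≈-trans (⟦⟧-⊛ (U ^P a) A U) (⊛-congˡ (σ A) (σ-U^ a)))
                        (≈-trans (⟦⟧-⊛ (T ^P a) (σ A) U) (⊛-cong (σ-T^ a) (σ-involutive A))))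
                σE≈E ⟩
    T ^P a ⊛ σ A ⊕ U ^P a ⊛ A ⊕ E
      ≈⟨ ⊕-congʳ E (⊕-comm (T ^P a ⊛ σ A) (U ^P a ⊛ A)) ⟩
    D ∎
    where open ≈-Reasoning
  degD : Deg≤ (a + a′) D
  degD = Deg-⊕ (Deg-⊕ (Deg-⊛ (Deg-U^ a) degA) (Deg-⊛ (Deg-T^ a) (Deg-σ A degA)))
               (Deg-mono (ℕₚ.m≤m+n a a′) degE)
  D≃0 : D ≃[ a ] []
  D≃0 = ≃-trans (≃-⊕ (≃-⊕ U^A≃E (T^⊛≃0 a (σ A))) (≈⇒≃ (≈-refl {E})))
                (≈⇒≃ (≈-trans (⊕-congʳ E (⊕-identityʳ E)) (⊕-self E)))

σ-S₁-num : ∀ c → σ (S₁-num c) ≈ S₁-num c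
σ-S₁-num c = ≈-trans (⟦⟧-⊕ (U ^P c) (T ^P c) U) (≈-trans (⊕-cong (σ-U^ c) (σ-T^ c)) (⊕-comm (T ^P c) (U ^P c)))

Deg-S₁-num : ∀ c → Deg≤ c (S₁-num c)
Deg-S₁-num c = Deg-⊕ (Deg-U^ c) (Deg-T^ c)

U^2^m⊛-≃ : ∀ m {a} w → a ≤ 2 ^ m → U ^P (2 ^ m) ⊛ w ≃[ a ] w
U^2^m⊛-≃ m w a≤2^m = ≃-trans (≈⇒≃ expand) (≃-trans (≃-⊕ (≈⇒≃ (≈-refl {w})) (≃-weaken a≤2^m (T^⊛≃0 (2 ^ m) w)))
                                                   (≈⇒≃ (⊕-identityʳ w)))
  where
  expand : U ^P (2 ^ m) ⊛ w ≈ w ⊕ T ^P (2 ^ m) ⊛ w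
  expand = ≈-trans (⊛-congˡ w (U^2^m m))
                   (≈-trans (⊛-distribʳ oneP (T ^P (2 ^ m)) w) (⊕-congʳ (T ^P (2 ^ m) ⊛ w) (⊛-identityˡ w)))

-- The key identity: with A = Σ_{k<a} f_k tᵏ,
--   (t + 1)ᵃ A + tᵃ σA = (t + 1)^(a-b) + t^(a-b).
-- Indeed A ≡ (t + 1)^(2^m - a) ((t + 1)^(a-b) + t^(a-b)) (mod tᵃ) by the
-- definition of f_k, so (t + 1)ᵃ A ≡ (t + 1)^(2^m) (…) ≡ (…) (mod tᵃ).
key-identity : ∀ a b m → b < a → a ≤ 2 ^ m →
  let A = poly a (fcoef a b m) in U ^P a ⊛ A ⊕ T ^P a ⊛ σ A ≈ S₁-num (a ∸ b)
key-identity (suc a′) b m b<a a≤2^m =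
  symmetric-completion a′ A E (σ-S₁-num c) (Deg-mono (ℕₚ.m∸n≤m a b) (Deg-S₁-num c)) (Deg-poly a′ f)
    (≃-trans (⊛-≃ (U ^P a) A≃U^rE) (≃-trans (≈⇒≃ U^a⊛U^r⊛E≈U^2^m⊛E) (U^2^m⊛-≃ m E a≤2^m)))
  where
  a c r : ℕ
  a = suc a′
  c = a ∸ b
  r = 2 ^ m ∸ a
  f : ℕ → Bool
  f = fcoef a b m
  A E : Poly
  A = poly a f
  E = S₁-num c
  A≃U^rE : A ≃[ a ] U ^P r ⊛ E
  A≃U^rE = mk≃ λ k k<a → ≡.trans (coeff-poly-< a f k k<a) (binomial-sum≡coeff r c (ℕₚ.m<n⇒0<n∸m b<a) k)
  U^a⊛U^r⊛E≈U^2^m⊛E : U ^P a ⊛ (U ^P r ⊛ E) ≈ U ^P (2 ^ m) ⊛ E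
  U^a⊛U^r⊛E≈U^2^m⊛E = ≈-trans (≈-sym (⊛-assoc (U ^P a) (U ^P r) E))
    (⊛-congˡ E (≈-trans (≈-sym (^-+ U a r)) (^-congʳ U (ℕₚ.m+[n∸m]≡n a≤2^m))))

NonZeroDivisor : Poly → Set
NonZeroDivisor w = ∀ z → z ⊛ w ≈ [] → z ≈ []

cancel : ∀ {w} → NonZeroDivisor w → ∀ {x y} → x ⊛ w ≈ y ⊛ w → x ≈ y
cancel {w} nzd {x} {y} h = ⊕≈0⇒≈ (nzd (x ⊕ y) (begin
  (x ⊕ y) ⊛ w      ≈⟨ ⊛-distribʳ x y w ⟩
  x ⊛ w ⊕ y ⊛ w    ≈⟨ ⊕-congʳ (y ⊛ w) h ⟩
  y ⊛ w ⊕ y ⊛ w    ≈⟨ ⊕-self (y ⊛ w) ⟩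
  []               ∎))
  where open ≈-Reasoning

NonZeroDivisor-⊛ : ∀ {v w} → NonZeroDivisor v → NonZeroDivisor w → NonZeroDivisor (v ⊛ w)
NonZeroDivisor-⊛ {v} {w} nv nw z h = nv z (nw (z ⊛ v) (≈-trans (⊛-assoc z v w) h))

NonZeroDivisor-^ : ∀ {w} k → NonZeroDivisor w → NonZeroDivisor (w ^P k)
NonZeroDivisor-^ zero    nw z h = ≈-trans (≈-sym (⊛-identityʳ z)) h
NonZeroDivisor-^ (suc k) nw     = NonZeroDivisor-⊛ nw (NonZeroDivisor-^ k nw)

NonZeroDivisor-T : NonZeroDivisor T
NonZeroDivisor-T z h = ∷-tail (≈-trans (≈-sym (T⊛ z)) (≈-trans (⊛-comm T z) (≈-trans h (≈-sym false∷[]≈[]))))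

NonZeroDivisor-U : NonZeroDivisor U
NonZeroDivisor-U z h = mk≈ λ n → coeff-≃ (U-cancel (≈⇒≃ (≈-trans (⊛-comm U z) h))) n (ℕₚ.n<1+n n)

NonZeroDivisor-T^U^ : ∀ k → NonZeroDivisor (T ^P k ⊛ U ^P k)
NonZeroDivisor-T^U^ k = NonZeroDivisor-⊛ (NonZeroDivisor-^ k NonZeroDivisor-T) (NonZeroDivisor-^ k NonZeroDivisor-U)

record Represents (x : K) (P D : Poly) : Set where
  constructor mkRep
  field cross : num x ⊛ D ≈ P ⊛ den x
open Represents public

Represents-cong : ∀ {x P P′ D D′} → P ≈ P′ → D ≈ D′ → Represents x P D → Represents x P′ D′
Represents-cong {x} hP hD (mkRep h) =
  mkRep (≈-trans (⊛-congʳ (num x) (≈-sym hD)) (≈-trans h (⊛-congˡ (den x) hP)))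

Represents-unique : ∀ {x y P D} → NonZeroDivisor D → Represents x P D → Represents y P D → x ≈K y
Represents-unique {x} {y} {P} {D} nzd (mkRep h) (mkRep g) = coeff-≈ (cancel nzd {num x ⊛ den y} {num y ⊛ den x} (begin
  (num x ⊛ den y) ⊛ D   ≈⟨ ⊛-swap (num x) (den y) D ⟩
  (num x ⊛ D) ⊛ den y   ≈⟨ ⊛-congˡ (den y) h ⟩
  (P ⊛ den x) ⊛ den y   ≈⟨ ⊛-swap P (den x) (den y) ⟩
  (P ⊛ den y) ⊛ den x   ≈⟨ ⊛-congˡ (den x) g ⟨
  (num y ⊛ D) ⊛ den x   ≈⟨ ⊛-swap (num y) D (den x) ⟩
  (num y ⊛ den x) ⊛ D   ∎))
  where open ≈-Reasoning

Represents-S₁ : ∀ s → Represents (S₁ s) (S₁-num s) (T ^P s ⊛ U ^P s)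
Represents-S₁ s = mkRep (⊛-congˡ (T ^P s ⊛ U ^P s) (⊕-cong (⊛-identityˡ (U ^P s)) (⊛-identityˡ (T ^P s))))

Represents-F₂ : ∀ c → Represents (fromF₂ c) (c ∷ []) oneP
Represents-F₂ true  = mkRep ≈-refl
Represents-F₂ false = mkRep (≈-sym (⊛-zeroˡ oneP false∷[]≈[]))

Represents-*K : ∀ {x y P Q D E} → Represents x P D → Represents y Q E → Represents (x *K y) (P ⊛ Q) (D ⊛ E)
Represents-*K {x} {y} {P} {Q} {D} {E} (mkRep h) (mkRep g) = mkRep (begin
  (num x ⊛ num y) ⊛ (D ⊛ E)        ≈⟨ ⊛-medial (num x) (num y) D E ⟩
  (num x ⊛ D) ⊛ (num y ⊛ E)        ≈⟨ ⊛-cong h g ⟩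
  (P ⊛ den x) ⊛ (Q ⊛ den y)        ≈⟨ ⊛-medial P (den x) Q (den y) ⟩
  (P ⊛ Q) ⊛ (den x ⊛ den y)        ∎)
  where open ≈-Reasoning

Represents-+K : ∀ {x y P Q D} → Represents x P D → Represents y Q D → Represents (x +K y) (P ⊕ Q) D
Represents-+K {x} {y} {P} {Q} {D} (mkRep h) (mkRep g) = mkRep (begin
  (num x ⊛ den y ⊕ num y ⊛ den x) ⊛ D       ≈⟨ spread (num x) (den y) (num y) (den x) D ⟩
  (num x ⊛ D) ⊛ den y ⊕ (num y ⊛ D) ⊛ den x ≈⟨ ⊕-cong (⊛-congˡ (den y) h) (⊛-congˡ (den x) g) ⟩
  (P ⊛ den x) ⊛ den y ⊕ (Q ⊛ den y) ⊛ den x ≈⟨ collect P (den x) Q (den y) ⟩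
  (P ⊕ Q) ⊛ (den x ⊛ den y)                 ∎)
  where
  open ≈-Reasoning
  spread : ∀ p q r s d → (p ⊛ q ⊕ r ⊛ s) ⊛ d ≈ (p ⊛ d) ⊛ q ⊕ (r ⊛ d) ⊛ s
  spread = solve-∀ F₂[t]-solver
  collect : ∀ p q r s → (p ⊛ q) ⊛ s ⊕ (r ⊛ s) ⊛ q ≈ (p ⊕ r) ⊛ (q ⊛ s)
  collect = solve-∀ F₂[t]-solver

-- subtraction is addition in characteristic 2
Represents-subK : ∀ {x y P Q D} → Represents x P D → Represents y Q D → Represents (x -K y) (P ⊕ Q) D
Represents-subK = Represents-+K

Represents-extend : ∀ {x P D} w → Represents x P D → Represents x (P ⊛ w) (D ⊛ w)
Represents-extend {x} {P} {D} w (mkRep h) = mkRep (begin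
  num x ⊛ (D ⊛ w)   ≈⟨ ⊛-assoc (num x) D w ⟨
  (num x ⊛ D) ⊛ w   ≈⟨ ⊛-congˡ w h ⟩
  (P ⊛ den x) ⊛ w   ≈⟨ ⊛-swap P (den x) w ⟩
  (P ⊛ w) ⊛ den x   ∎)
  where open ≈-Reasoning

Represents-sumK : ∀ n {g P D} → (∀ k → k < n → Represents (g k) (P k) D) → Represents (sumK n g) (Σₚ n P) D
Represents-sumK zero    h = mkRep ≈-refl
Represents-sumK (suc n) h = Represents-+K (Represents-sumK n (λ k k<n → h k (ℕₚ.m<n⇒m<1+n k<n))) (h n (ℕₚ.n<1+n n))

T^U^-+ : ∀ a b → (T ^P a ⊛ U ^P a) ⊛ (T ^P b ⊛ U ^P b) ≈ T ^P (a + b) ⊛ U ^P (a + b)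
T^U^-+ a b = ≈-trans (⊛-medial (T ^P a) (U ^P a) (T ^P b) (U ^P b)) (≈-sym (⊛-cong (^-+ T a b) (^-+ U a b)))

Represents-Δ : ∀ {a b} → b ≤ a →
  Represents (Δ a b) (S₁-num (a ∸ b) ⊛ (T ^P b ⊛ U ^P b)) (T ^P (a + b) ⊛ U ^P (a + b))
Represents-Δ {a} {b} b≤a = Represents-cong numerator≈ ≈-refl
  (Represents-subK (Represents-cong ≈-refl (T^U^-+ a b) (Represents-*K (Represents-S₁ a) (Represents-S₁ b)))
                 (Represents-S₁ (a + b)))
  where
  open ≈-Reasoning
  c : ℕ
  c = a ∸ b
  split : ∀ p → p ^P a ≈ p ^P c ⊛ p ^P b
  split p = ≈-sym (^-∸ p b≤a)
  split₂ : ∀ p → p ^P (a + b) ≈ (p ^P c ⊛ p ^P b) ⊛ p ^P b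
  split₂ p = ≈-trans (^-+ p a b) (⊛-congˡ (p ^P b) (split p))
  cross-terms : ∀ u t v w → (u ⊛ v ⊕ t ⊛ w) ⊛ (v ⊕ w) ⊕ ((u ⊛ v) ⊛ v ⊕ (t ⊛ w) ⊛ w) ≈ (u ⊕ t) ⊛ (w ⊛ v)
  cross-terms = solve-∀ F₂[t]-solver
  numerator≈ : S₁-num a ⊛ S₁-num b ⊕ S₁-num (a + b) ≈ S₁-num c ⊛ (T ^P b ⊛ U ^P b)
  numerator≈ = begin
    (U ^P a ⊕ T ^P a) ⊛ (U ^P b ⊕ T ^P b) ⊕ (U ^P (a + b) ⊕ T ^P (a + b))
      ≈⟨ ⊕-cong (⊛-congˡ (U ^P b ⊕ T ^P b) (⊕-cong (split U) (split T))) (⊕-cong (split₂ U) (split₂ T)) ⟩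
    (U ^P c ⊛ U ^P b ⊕ T ^P c ⊛ T ^P b) ⊛ (U ^P b ⊕ T ^P b)
      ⊕ ((U ^P c ⊛ U ^P b) ⊛ U ^P b ⊕ (T ^P c ⊛ T ^P b) ⊛ T ^P b)
      ≈⟨ cross-terms (U ^P c) (T ^P c) (U ^P b) (T ^P b) ⟩
    S₁-num c ⊛ (T ^P b ⊛ U ^P b) ∎

Represents-Σ : ∀ a f → Represents (sumK a (λ k → fromF₂ (f k) *K S₁ (a ∸ k)))
                                  (U ^P a ⊛ poly a f ⊕ T ^P a ⊛ σ (poly a f)) (T ^P a ⊛ U ^P a)
Represents-Σ a f = Represents-cong numerator≈ ≈-refl (Represents-sumK a term)
  where
  open ≈-Reasoning
  P : ℕ → Poly
  P k = U ^P a ⊛ scale (f k) (T ^P k) ⊕ T ^P a ⊛ scale (f k) (U ^P k)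
  distribute : ∀ s u t uk tk → (s ⊛ (u ⊕ t)) ⊛ (tk ⊛ uk) ≈ (u ⊛ uk) ⊛ (s ⊛ tk) ⊕ (t ⊛ tk) ⊛ (s ⊛ uk)
  distribute = solve-∀ F₂[t]-solver
  regroup : ∀ s t u tk uk → (s ⊛ (t ⊛ u)) ⊛ (tk ⊛ uk) ≈ s ⊛ ((t ⊛ tk) ⊛ (u ⊛ uk))
  regroup = solve-∀ F₂[t]-solver
  term : ∀ k → k < a → Represents (fromF₂ (f k) *K S₁ (a ∸ k)) (P k) (T ^P a ⊛ U ^P a)
  term k k<a = Represents-cong num≈ den≈
    (Represents-extend (T ^P k ⊛ U ^P k) (Represents-*K (Represents-F₂ (f k)) (Represents-S₁ (a ∸ k))))
    where
    k≤a : k ≤ a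
    k≤a = ℕₚ.<⇒≤ k<a
    num≈ : ((f k ∷ []) ⊛ S₁-num (a ∸ k)) ⊛ (T ^P k ⊛ U ^P k) ≈ P k
    num≈ = begin
      ((f k ∷ []) ⊛ (U ^P (a ∸ k) ⊕ T ^P (a ∸ k))) ⊛ (T ^P k ⊛ U ^P k)
        ≈⟨ distribute (f k ∷ []) (U ^P (a ∸ k)) (T ^P (a ∸ k)) (U ^P k) (T ^P k) ⟩
      (U ^P (a ∸ k) ⊛ U ^P k) ⊛ ((f k ∷ []) ⊛ T ^P k) ⊕ (T ^P (a ∸ k) ⊛ T ^P k) ⊛ ((f k ∷ []) ⊛ U ^P k)
        ≈⟨ ⊕-cong (⊛-cong (^-∸ U k≤a) (const-⊛ (f k) (T ^P k))) (⊛-cong (^-∸ T k≤a) (const-⊛ (f k) (U ^P k))) ⟩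
      P k ∎
    den≈ : (oneP ⊛ (T ^P (a ∸ k) ⊛ U ^P (a ∸ k))) ⊛ (T ^P k ⊛ U ^P k) ≈ T ^P a ⊛ U ^P a
    den≈ = ≈-trans (regroup oneP (T ^P (a ∸ k)) (U ^P (a ∸ k)) (T ^P k) (U ^P k))
                   (≈-trans (⊛-identityˡ _) (⊛-cong (^-∸ T k≤a) (^-∸ U k≤a)))
  σ-scale-T^ : ∀ c k → σ (scale c (T ^P k)) ≈ scale c (U ^P k)
  σ-scale-T^ true  k = σ-T^ k
  σ-scale-T^ false k = ≈-refl
  numerator≈ : Σₚ a P ≈ U ^P a ⊛ poly a f ⊕ T ^P a ⊛ σ (poly a f)
  numerator≈ = begin
    Σₚ a P
      ≈⟨ Σₚ-⊕ a (λ k → U ^P a ⊛ scale (f k) (T ^P k)) (λ k → T ^P a ⊛ scale (f k) (U ^P k)) ⟩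
    Σₚ a (λ k → U ^P a ⊛ scale (f k) (T ^P k)) ⊕ Σₚ a (λ k → T ^P a ⊛ scale (f k) (U ^P k))
      ≈⟨ ⊕-cong (Σₚ-⊛ a (U ^P a) _) (Σₚ-⊛ a (T ^P a) _) ⟩
    U ^P a ⊛ poly a f ⊕ T ^P a ⊛ Σₚ a (λ k → scale (f k) (U ^P k))
      ≈⟨ ⊕-congˡ (U ^P a ⊛ poly a f) (⊛-congʳ (T ^P a)
           (≈-sym (≈-trans (σ-Σₚ a _) (Σₚ-cong a (λ k _ → σ-scale-T^ (f k) k))))) ⟩
    U ^P a ⊛ poly a f ⊕ T ^P a ⊛ σ (poly a f) ∎

theorem6p1 : (a b m : ℕ) → 1 ≤ b → b < a →
    a ≤ 2 ^ m → (∀ m′ → a ≤ 2 ^ m′ → m ≤ m′) →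
    Δ a b ≈K sumK a (λ k → fromF₂ (fcoef a b m k) *K S₁ (a ∸ k))
theorem6p1 a b m _ b<a a≤2^m _ =
  Represents-unique (NonZeroDivisor-T^U^ (a + b)) (Represents-Δ b≤a)
    (Represents-cong numerator≈ (T^U^-+ a b) (Represents-extend (T ^P b ⊛ U ^P b) (Represents-Σ a f)))
  where
  f : ℕ → Bool
  f = fcoef a b m
  b≤a : b ≤ a
  b≤a = ℕₚ.<⇒≤ b<a
  numerator≈ : (U ^P a ⊛ poly a f ⊕ T ^P a ⊛ σ (poly a f)) ⊛ (T ^P b ⊛ U ^P b)
               ≈ S₁-num (a ∸ b) ⊛ (T ^P b ⊛ U ^P b)
  numerator≈ = ⊛-congˡ (T ^P b ⊛ U ^P b) (key-identity a b m b<a a≤2^m)
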